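{- Let $G$ be a $k$-uniform hypergraph and $t$ a positive integer. Then $G$ is minimal non-odd-bipartite if and only if $t\circ G$ is minimal non-odd-bipartite.
   Context: A hypergraph has a finite vertex set and an edge set of distinct nonempty subsets, with no isolated vertices; $k$-uniform means every edge has $k$ vertices. Given $G$, take $t$ disjoint copies $G^1,\dots,G^t$, where $v^i$ and $e^i$ denote the copies in $G^i$ of a vertex $v$ and an edge $e$. The hypergraph $t\circ G$ has vertex set $\bigcup_{i=1}^t V(G^i)$ and edge set $\{e^1\cup\cdots\cup e^t: e\in E(G)\}$; it is $tk$-uniform. For $\ell$ even, an $\ell$-uniform hypergraph $H$ is odd-bipartite if there is a bipartition $\{U,U^c\}$ of $V(H)$ such that every edge meets $U$ (and hence $U^c$) in an odd number of vertices; $H$ is minimal non-odd-bipartite if it is not odd-bipartite but $H-e$ (delete the edge $e$ from the edge set) is odd-bipartite for every edge $e$. -}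

module Defs where

open import Data.Nat using (ℕ; _*_; _%_)
open import Data.Fin using (Fin; remainder)
open import Data.Fin.Subset using (Subset; _∈_; _∩_; ∁; ∣_∣; Nonempty)
open import Data.Product using (Σ; ∃; _×_)
open import Relation.Binary.PropositionalEquality using (_≡_; _≢_)
open import Relation.Nullary using (¬_)
open import Function.Definitions using (Injective)
open import Data.Unit using (⊤)
open import Data.Vec using (tabulate; lookup)

Odd : ℕ → Set
Odd x = x % 2 ≡ 1

Even : ℕ → Set
Even x = x % 2 ≡ 0

record RawHG : Set where
  constructor mkRaw
  field
    n    : ℕ
    m    : ℕ
    edge : Fin m → Subset n
open RawHG public

record IsHypergraph (H : RawHG) : Set where
  field
    distinct    : Injective _≡_ _≡_ (edge H)
    nonemptyE   : ∀ i → Nonempty (edge H i)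
    noIsolated  : ∀ (v : Fin (n H)) → ∃ λ i → v ∈ edge H i
open IsHypergraph public

Uniform : ℕ → RawHG → Set
Uniform k H = ∀ i → ∣ edge H i ∣ ≡ k

OddBipartitionOn : (H : RawHG) → (Fin (m H) → Set) → Subset (n H) → Set
OddBipartitionOn H P U =
  ∀ i → P i → Odd ∣ edge H i ∩ U ∣ × Odd ∣ edge H i ∩ ∁ U ∣

OddBipartite : RawHG → Set
OddBipartite H = ∃ λ (U : Subset (n H)) → OddBipartitionOn H (λ _ → ⊤) U

OddBipartiteMinus : (H : RawHG) → Fin (m H) → Set
OddBipartiteMinus H j = ∃ λ (U : Subset (n H)) → OddBipartitionOn H (λ i → i ≢ j) U

MinimalNonOddBipartite : RawHG → Set
MinimalNonOddBipartite H = ¬ OddBipartite H × (∀ j → OddBipartiteMinus H j)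

-- t ∘ G: vertex set Fin (t * n) ≅ Fin t × Fin n (copy index, original vertex);
-- the edge for e is e¹ ∪ ⋯ ∪ eᵗ, i.e. contains vertex (i , v) iff v ∈ e.
_∘H_ : ℕ → RawHG → RawHG
t ∘H G = mkRaw (t * n G) (m G)
  (λ i → tabulate (λ x → lookup (edge G i) (remainder {t} (n G) x)))

{-# OPTIONS --safe #-}
module Submission where

-- Since every edge has even size, U is an odd bipartition for a family of
-- edges as soon as each of them meets U in an odd number of vertices.  That
-- condition only involves parities, and the parity of |(e¹ ∪ ⋯ ∪ eᵗ) ∩ U| is
-- the parity of |e ∩ (U¹ ⊕ ⋯ ⊕ Uᵗ)|, where Uⁱ is the trace of U on the copy Gⁱ
-- and ⊕ is symmetric difference.  So a good U for t ∘ G folds to a good set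
-- for G, and a good set for G placed in the first copy is good for t ∘ G.  As
-- both hypergraphs have the same edge indices, this holds for every family of
-- edges at once, in particular for E(G) and for each E(G) ∖ {e}.

open import Defs
open import Data.Bool using (_xor_; true; false)
open import Data.Bool.Properties using (∧-distribˡ-xor)
open import Data.Fin using (Fin; _↑ˡ_; _↑ʳ_; remainder)
import Data.Fin as Fin
open import Data.Fin.Properties using (splitAt-↑ˡ; splitAt-↑ʳ)
open import Data.Fin.Subset using (Subset; _∩_; ∁; ∣_∣; ⊥; ⊤)
open import Data.Fin.Subset.Properties using (∩-zeroʳ; ∣⊥∣≡0; ∩-identityʳ)
open import Data.Nat using (ℕ; _≥_; zero; suc; _+_; _*_; _%_; parity)
open import Data.Parity.Base using (Parity; 0ℙ; 1ℙ) renaming (_+_ to _⊞_; _*_ to _⊠_)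
import Data.Parity.Properties as ℙ
open import Algebra.Properties.CommutativeSemigroup ℙ.+-commutativeSemigroup
  using (interchange)
open import Data.Product using (_×_; _,_; proj₁; ∃; map₂)
open import Data.Vec using ([]; _∷_; _++_; tabulate; lookup; zipWith; take; drop)
open import Data.Vec.Properties
  using (tabulate-cong; tabulate∘lookup; zipWith-++; take++drop≡id; zipWith-distribˡ)
open import Function using (_∘_)
open import Function.Bundles using (_⇔_; mk⇔; Equivalence)
import Function.Properties.Equivalence as ⇔
open import Relation.Binary.PropositionalEquality
  using (_≡_; _≢_; refl; sym; trans; cong; cong₂; module ≡-Reasoning)
open import Data.Unit using () renaming (⊤ to Unit)

open Equivalence using (to; from)

parityToℕ : Parity → ℕ
parityToℕ 0ℙ = 0
parityToℕ 1ℙ = 1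

n%2≡parityToℕ : ∀ n → n % 2 ≡ parityToℕ (parity n)
n%2≡parityToℕ zero = refl
n%2≡parityToℕ (suc zero) = refl
n%2≡parityToℕ (suc (suc n)) = n%2≡parityToℕ n

parityToℕ-injective : ∀ {p q} → parityToℕ p ≡ parityToℕ q → p ≡ q
parityToℕ-injective {0ℙ} {0ℙ} _ = refl
parityToℕ-injective {1ℙ} {1ℙ} _ = refl

Odd⇔parity≡1ℙ : ∀ n → Odd n ⇔ parity n ≡ 1ℙ
Odd⇔parity≡1ℙ n = mk⇔
  (λ odd → parityToℕ-injective (trans (sym (n%2≡parityToℕ n)) odd))
  (λ eq → trans (n%2≡parityToℕ n) (cong parityToℕ eq))

Even⇒parity≡0ℙ : ∀ n → Even n → parity n ≡ 0ℙ
Even⇒parity≡0ℙ n even = parityToℕ-injective (trans (sym (n%2≡parityToℕ n)) even)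

∃-⇔ : ∀ {A : Set} {P Q : A → Set} → (∀ x → P x ⇔ Q x) → ∃ P ⇔ ∃ Q
∃-⇔ P⇔Q = mk⇔ (map₂ (to (P⇔Q _))) (map₂ (from (P⇔Q _)))

infixl 6 _⊕_

_⊕_ : ∀ {n} → Subset n → Subset n → Subset n
_⊕_ = zipWith _xor_

∣p++q∣≡∣p∣+∣q∣ : ∀ {m n} (p : Subset m) (q : Subset n) → ∣ p ++ q ∣ ≡ ∣ p ∣ + ∣ q ∣
∣p++q∣≡∣p∣+∣q∣ [] q = refl
∣p++q∣≡∣p∣+∣q∣ (true ∷ p) q = cong suc (∣p++q∣≡∣p∣+∣q∣ p q)
∣p++q∣≡∣p∣+∣q∣ (false ∷ p) q = ∣p++q∣≡∣p∣+∣q∣ p q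

parity∣p++q∣ : ∀ {m n} (p : Subset m) (q : Subset n) →
  parity ∣ p ++ q ∣ ≡ parity ∣ p ∣ ⊞ parity ∣ q ∣
parity∣p++q∣ p q = trans (cong parity (∣p++q∣≡∣p∣+∣q∣ p q)) (ℙ.+-homo-+ ∣ p ∣ ∣ q ∣)

parity∣[p++q]∩[r++s]∣ : ∀ {m n} (p r : Subset m) (q s : Subset n) →
  parity ∣ (p ++ q) ∩ (r ++ s) ∣ ≡ parity ∣ p ∩ r ∣ ⊞ parity ∣ q ∩ s ∣
parity∣[p++q]∩[r++s]∣ p r q s =
  trans (cong (parity ∘ ∣_∣) (zipWith-++ _ p q r s)) (parity∣p++q∣ (p ∩ r) (q ∩ s))

parity∣p⊕q∣ : ∀ {n} (p q : Subset n) → parity ∣ p ⊕ q ∣ ≡ parity ∣ p ∣ ⊞ parity ∣ q ∣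
parity∣p⊕q∣ [] [] = refl
parity∣p⊕q∣ (x ∷ p) (y ∷ q) = begin
  parity ∣ (x xor y) ∷ (p ⊕ q) ∣
    ≡⟨ parity∣p++q∣ ((x xor y) ∷ []) (p ⊕ q) ⟩
  parity ∣ (x xor y) ∷ [] ∣ ⊞ parity ∣ p ⊕ q ∣
    ≡⟨ cong₂ _⊞_ (parity∣x⊕y∣ x y) (parity∣p⊕q∣ p q) ⟩
  (parity ∣ x ∷ [] ∣ ⊞ parity ∣ y ∷ [] ∣) ⊞ (parity ∣ p ∣ ⊞ parity ∣ q ∣)
    ≡⟨ interchange (parity ∣ x ∷ [] ∣) (parity ∣ y ∷ [] ∣) (parity ∣ p ∣) (parity ∣ q ∣) ⟩
  (parity ∣ x ∷ [] ∣ ⊞ parity ∣ p ∣) ⊞ (parity ∣ y ∷ [] ∣ ⊞ parity ∣ q ∣)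
    ≡⟨ sym (cong₂ _⊞_ (parity∣p++q∣ (x ∷ []) p) (parity∣p++q∣ (y ∷ []) q)) ⟩
  parity ∣ x ∷ p ∣ ⊞ parity ∣ y ∷ q ∣ ∎
  where
  open ≡-Reasoning
  parity∣x⊕y∣ : ∀ x y →
    parity ∣ (x xor y) ∷ [] ∣ ≡ parity ∣ x ∷ [] ∣ ⊞ parity ∣ y ∷ [] ∣
  parity∣x⊕y∣ true true = refl
  parity∣x⊕y∣ true false = refl
  parity∣x⊕y∣ false _ = refl

∩-distribˡ-⊕ : ∀ {n} (p q r : Subset n) → p ∩ (q ⊕ r) ≡ (p ∩ q) ⊕ (p ∩ r)
∩-distribˡ-⊕ = zipWith-distribˡ ∧-distribˡ-xor

parity∣p∩[q⊕r]∣ : ∀ {n} (p q r : Subset n) →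
  parity ∣ p ∩ (q ⊕ r) ∣ ≡ parity ∣ p ∩ q ∣ ⊞ parity ∣ p ∩ r ∣
parity∣p∩[q⊕r]∣ p q r =
  trans (cong (parity ∘ ∣_∣) (∩-distribˡ-⊕ p q r)) (parity∣p⊕q∣ (p ∩ q) (p ∩ r))

p⊕∁p≡⊤ : ∀ {n} (p : Subset n) → p ⊕ ∁ p ≡ ⊤
p⊕∁p≡⊤ [] = refl
p⊕∁p≡⊤ (true ∷ p) = cong (true ∷_) (p⊕∁p≡⊤ p)
p⊕∁p≡⊤ (false ∷ p) = cong (true ∷_) (p⊕∁p≡⊤ p)

parity∣p∩q∣+parity∣p∩∁q∣ : ∀ {n} (p q : Subset n) →
  parity ∣ p ∩ q ∣ ⊞ parity ∣ p ∩ ∁ q ∣ ≡ parity ∣ p ∣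
parity∣p∩q∣+parity∣p∩∁q∣ p q = begin
  parity ∣ p ∩ q ∣ ⊞ parity ∣ p ∩ ∁ q ∣  ≡⟨ sym (parity∣p∩[q⊕r]∣ p q (∁ q)) ⟩
  parity ∣ p ∩ (q ⊕ ∁ q) ∣               ≡⟨ cong (λ r → parity ∣ p ∩ r ∣) (p⊕∁p≡⊤ q) ⟩
  parity ∣ p ∩ ⊤ ∣                       ≡⟨ cong (parity ∘ ∣_∣) (∩-identityʳ p) ⟩
  parity ∣ p ∣                           ∎
  where open ≡-Reasoning

parity∣p∩⊥∣≡0ℙ : ∀ {n} (p : Subset n) → parity ∣ p ∩ ⊥ ∣ ≡ 0ℙ
parity∣p∩⊥∣≡0ℙ {n} p = cong parity (trans (cong ∣_∣ (∩-zeroʳ p)) (∣⊥∣≡0 n))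

oddSplit⇔oddMeet : ∀ {n} (x U : Subset n) → parity ∣ x ∣ ≡ 0ℙ →
  (Odd ∣ x ∩ U ∣ × Odd ∣ x ∩ ∁ U ∣) ⇔ parity ∣ x ∩ U ∣ ≡ 1ℙ
oddSplit⇔oddMeet x U x-even = mk⇔
  (to (Odd⇔parity≡1ℙ ∣ x ∩ U ∣) ∘ proj₁)
  (λ meet → from (Odd⇔parity≡1ℙ ∣ x ∩ U ∣) meet ,
            from (Odd⇔parity≡1ℙ ∣ x ∩ ∁ U ∣) (complement-odd meet))
  where
  complement-odd : parity ∣ x ∩ U ∣ ≡ 1ℙ → parity ∣ x ∩ ∁ U ∣ ≡ 1ℙ
  complement-odd meet = ℙ.+-cancelˡ-≡ 1ℙ _ 1ℙ (begin
    1ℙ ⊞ parity ∣ x ∩ ∁ U ∣                ≡⟨ cong (_⊞ parity ∣ x ∩ ∁ U ∣) (sym meet) ⟩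
    parity ∣ x ∩ U ∣ ⊞ parity ∣ x ∩ ∁ U ∣  ≡⟨ parity∣p∩q∣+parity∣p∩∁q∣ x U ⟩
    parity ∣ x ∣                           ≡⟨ x-even ⟩
    0ℙ                                     ∎)
    where open ≡-Reasoning

copies : ∀ t {n} → Subset n → Subset (t * n)
copies t {n} e = tabulate (λ x → lookup e (remainder {t} n x))

overlay : ∀ t {n} → Subset (t * n) → Subset n
overlay zero U = ⊥
overlay (suc t) {n} U = take n U ⊕ overlay t (drop n U)

tabulate-++ : ∀ {A : Set} m n (f : Fin (m + n) → A) →
  tabulate f ≡ tabulate (f ∘ (_↑ˡ n)) ++ tabulate (f ∘ (m ↑ʳ_))
tabulate-++ zero n f = refl
tabulate-++ (suc m) n f = cong (f Fin.zero ∷_) (tabulate-++ m n (f ∘ Fin.suc))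

remainder-↑ˡ : ∀ t n (i : Fin n) → remainder {suc t} n (i ↑ˡ (t * n)) ≡ i
remainder-↑ˡ t n i rewrite splitAt-↑ˡ n i (t * n) = refl

remainder-↑ʳ : ∀ t n (j : Fin (t * n)) → remainder {suc t} n (n ↑ʳ j) ≡ remainder {t} n j
remainder-↑ʳ t n j rewrite splitAt-↑ʳ n (t * n) j = refl

copies-suc : ∀ t {n} (e : Subset n) → copies (suc t) e ≡ e ++ copies t e
copies-suc t {n} e = trans (tabulate-++ n (t * n) _)
  (cong₂ _++_
    (trans (tabulate-cong (cong (lookup e) ∘ remainder-↑ˡ t n)) (tabulate∘lookup e))
    (tabulate-cong (cong (lookup e) ∘ remainder-↑ʳ t n)))

∣copies∣≡t*∣e∣ : ∀ t {n} (e : Subset n) → ∣ copies t e ∣ ≡ t * ∣ e ∣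
∣copies∣≡t*∣e∣ zero e = refl
∣copies∣≡t*∣e∣ (suc t) e = begin
  ∣ copies (suc t) e ∣     ≡⟨ cong ∣_∣ (copies-suc t e) ⟩
  ∣ e ++ copies t e ∣      ≡⟨ ∣p++q∣≡∣p∣+∣q∣ e (copies t e) ⟩
  ∣ e ∣ + ∣ copies t e ∣   ≡⟨ cong (∣ e ∣ +_) (∣copies∣≡t*∣e∣ t e) ⟩
  ∣ e ∣ + t * ∣ e ∣        ∎
  where open ≡-Reasoning

parity∣copies∩[U++V]∣ : ∀ t {n} (e U : Subset n) (V : Subset (t * n)) →
  parity ∣ copies (suc t) e ∩ (U ++ V) ∣ ≡ parity ∣ e ∩ U ∣ ⊞ parity ∣ copies t e ∩ V ∣
parity∣copies∩[U++V]∣ t e U V =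
  trans (cong (λ c → parity ∣ c ∩ (U ++ V) ∣) (copies-suc t e))
        (parity∣[p++q]∩[r++s]∣ e U (copies t e) V)

parity∣copies∩U∣≡parity∣e∩overlay∣ : ∀ t {n} (e : Subset n) (U : Subset (t * n)) →
  parity ∣ copies t e ∩ U ∣ ≡ parity ∣ e ∩ overlay t U ∣
parity∣copies∩U∣≡parity∣e∩overlay∣ zero e [] = sym (parity∣p∩⊥∣≡0ℙ e)
parity∣copies∩U∣≡parity∣e∩overlay∣ (suc t) {n} e U = begin
  parity ∣ copies (suc t) e ∩ U ∣
    ≡⟨ cong (λ W → parity ∣ copies (suc t) e ∩ W ∣) (sym (take++drop≡id n U)) ⟩
  parity ∣ copies (suc t) e ∩ (take n U ++ drop n U) ∣
    ≡⟨ parity∣copies∩[U++V]∣ t e (take n U) (drop n U) ⟩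
  parity ∣ e ∩ take n U ∣ ⊞ parity ∣ copies t e ∩ drop n U ∣
    ≡⟨ cong (parity ∣ e ∩ take n U ∣ ⊞_) (parity∣copies∩U∣≡parity∣e∩overlay∣ t e (drop n U)) ⟩
  parity ∣ e ∩ take n U ∣ ⊞ parity ∣ e ∩ overlay t (drop n U) ∣
    ≡⟨ sym (parity∣p∩[q⊕r]∣ e (take n U) (overlay t (drop n U))) ⟩
  parity ∣ e ∩ overlay (suc t) U ∣ ∎
  where open ≡-Reasoning

parity∣copies∩[U++⊥]∣ : ∀ t {n} (e U : Subset n) →
  parity ∣ copies (suc t) e ∩ (U ++ ⊥) ∣ ≡ parity ∣ e ∩ U ∣
parity∣copies∩[U++⊥]∣ t e U = begin
  parity ∣ copies (suc t) e ∩ (U ++ ⊥) ∣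
    ≡⟨ parity∣copies∩[U++V]∣ t e U ⊥ ⟩
  parity ∣ e ∩ U ∣ ⊞ parity ∣ copies t e ∩ ⊥ ∣
    ≡⟨ cong (parity ∣ e ∩ U ∣ ⊞_) (parity∣p∩⊥∣≡0ℙ (copies t e)) ⟩
  parity ∣ e ∩ U ∣ ⊞ 0ℙ
    ≡⟨ ℙ.+-identityʳ (parity ∣ e ∩ U ∣) ⟩
  parity ∣ e ∩ U ∣ ∎
  where open ≡-Reasoning

EvenEdges : RawHG → Set
EvenEdges H = ∀ i → parity ∣ edge H i ∣ ≡ 0ℙ

OddTransversalOn : (H : RawHG) → (Fin (m H) → Set) → Subset (n H) → Set
OddTransversalOn H P U = ∀ i → P i → parity ∣ edge H i ∩ U ∣ ≡ 1ℙ

oddBipartition⇔oddTransversal : ∀ H → EvenEdges H → ∀ P U →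
  OddBipartitionOn H P U ⇔ OddTransversalOn H P U
oddBipartition⇔oddTransversal H even P U = mk⇔
  (λ split i p → to (meet⇔ i) (split i p))
  (λ meet i p → from (meet⇔ i) (meet i p))
  where
  meet⇔ : ∀ i → (Odd ∣ edge H i ∩ U ∣ × Odd ∣ edge H i ∩ ∁ U ∣) ⇔ parity ∣ edge H i ∩ U ∣ ≡ 1ℙ
  meet⇔ i = oddSplit⇔oddMeet (edge H i) U (even i)

∘H-evenEdges : ∀ t G → EvenEdges G → EvenEdges (t ∘H G)
∘H-evenEdges t G even i = begin
  parity ∣ copies t (edge G i) ∣  ≡⟨ cong parity (∣copies∣≡t*∣e∣ t (edge G i)) ⟩
  parity (t * ∣ edge G i ∣)       ≡⟨ ℙ.*-homo-* t ∣ edge G i ∣ ⟩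
  parity t ⊠ parity ∣ edge G i ∣  ≡⟨ cong (parity t ⊠_) (even i) ⟩
  parity t ⊠ 0ℙ                   ≡⟨ ℙ.*-zeroʳ (parity t) ⟩
  0ℙ                              ∎
  where open ≡-Reasoning

oddTransversal-∘H : ∀ t G P →
  ∃ (OddTransversalOn G P) ⇔ ∃ (OddTransversalOn (suc t ∘H G) P)
oddTransversal-∘H t G P = mk⇔
  (λ (U , meet) → U ++ ⊥ , λ i p →
    trans (parity∣copies∩[U++⊥]∣ t (edge G i) U) (meet i p))
  (λ (U , meet) → overlay (suc t) U , λ i p →
    trans (sym (parity∣copies∩U∣≡parity∣e∩overlay∣ (suc t) (edge G i) U)) (meet i p))

oddBipartition-∘H : ∀ t G → EvenEdges G → ∀ P →
  ∃ (OddBipartitionOn G P) ⇔ ∃ (OddBipartitionOn (suc t ∘H G) P)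
oddBipartition-∘H t G even P =
  ⇔.trans (∃-⇔ (oddBipartition⇔oddTransversal G even P))
  (⇔.trans (oddTransversal-∘H t G P)
  (⇔.sym (∃-⇔ (oddBipartition⇔oddTransversal (suc t ∘H G) (∘H-evenEdges (suc t) G even) P))))

minimalNonOddBipartite-∘H : ∀ t G →
  (∀ P → ∃ (OddBipartitionOn G P) ⇔ ∃ (OddBipartitionOn (t ∘H G) P)) →
  MinimalNonOddBipartite G ⇔ MinimalNonOddBipartite (t ∘H G)
minimalNonOddBipartite-∘H t G same = mk⇔
  (λ (notOB , minusOB) → notOB ∘ from (same (λ _ → Unit)) , λ j → to (same (_≢ j)) (minusOB j))
  (λ (notOB , minusOB) → notOB ∘ to (same (λ _ → Unit)) , λ j → from (same (_≢ j)) (minusOB j))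

lemma4p9 : (G : RawHG) → IsHypergraph G → (k : ℕ) → Even k → Uniform k G →
    (t : ℕ) → t ≥ 1 →
    (MinimalNonOddBipartite G ⇔ MinimalNonOddBipartite (t ∘H G))
lemma4p9 G _ k k-even uniform (suc t) _ =
  minimalNonOddBipartite-∘H (suc t) G (oddBipartition-∘H t G even)
  where
  even : EvenEdges G
  even i = trans (cong parity (uniform i)) (Even⇒parity≡0ℙ k k-even)
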